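{- Let $B_i=(Q_i,P_i,\to,\rightsquigarrow)$, $i\in[1,n]$, be behaviours with pairwise disjoint port sets, $P=\bigcup_{i=1}^n P_i$, and $X=P\cup\dot P\cup\overline{P}$. Let $\gamma_1\subseteq 2^{X}$ be a set of interactions and $\gamma_2=\gamma_1\cup\{a\}$ with $a\subseteq X$, such that there is an interaction $b\in\gamma_1$ with $b\subseteq a$ and $\dot{\mathrm{sup}}(b)=\dot{\mathrm{sup}}(a)$. Then $\gamma_1(B_1,\dots,B_n)=\gamma_2(B_1,\dots,B_n)$.
   Context: A labelled transition system is $(Q,P,\to)$ with states $Q$, ports $P$, and transitions $\to\subseteq Q\times 2^P\times Q$; it is assumed that $q\xrightarrow{\emptyset}q$ for every state $q$. A behaviour is $B=(Q,P,\to,\rightsquigarrow)$ where $(Q,P,\to)$ is such an LTS and $\rightsquigarrow\subseteq Q\times P$ is an offer predicate satisfying: if $q\xrightarrow{a}$ for some $a$ with $p\in a$, then $q\rightsquigarrow p$. For $a\subseteq P$, $q\rightsquigarrow a$ means $q\rightsquigarrow p$ for all $p\in a$. For a port set $P$ write $\dot P=\{\dot p: p\in P\}$ (firing typings), $P$ itself (activation typings) and $\overline P=\{\overline p:p\in P\}$ (negative typings). An interaction is a subset $a\subseteq P\cup\dot P\cup\overline P$; its activation support is $a\cap P$, its firing support is $\dot{\mathrm{sup}}(a)=\{p\in P:\dot p\in a\}$, and its negative support is $\overline{\mathrm{sup}}(a)=\{p\in P:\overline p\in a\}$. For behaviours $B_i$ as in the claim and $\gamma\subseteq 2^{P\cup\dot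 P\cup\overline P}$, the composition $\gamma(B_1,\dots,B_n)=(Q,P,\to,\rightsquigarrow)$ has $Q=\prod_i Q_i$; offer predicate the least one with $q_1\dots q_n\rightsquigarrow p$ whenever $q_i\rightsquigarrow p$ for some $i$; and the least transition relation such that $q_1\dots q_n\xrightarrow{\dot{\mathrm{sup}}(a)}q_1'\dots q_n'$ whenever $a\in\gamma$ and, for every $i$: $q_i\xrightarrow{\dot{\mathrm{sup}}(a)\cap P_i}q_i'$, $q_i\rightsquigarrow (a\cap P\cap P_i)$, and $q_i\not\rightsquigarrow p$ for every $p\in\overline{\mathrm{sup}}(a)\cap P_i$. -}

module Defs where

open import Data.Bool using (Bool; true; false)
open import Data.Fin using (Fin)
open import Data.Nat using (ℕ)
open import Data.Product using (Σ; _,_)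
open import Data.Sum using (_⊎_)
open import Relation.Binary.PropositionalEquality using (_≡_)
open import Relation.Nullary using (¬_)

Subset : Set → Set
Subset A = A → Bool

_∈_ : {A : Set} → A → Subset A → Set
x ∈ s = s x ≡ true

_⊆_ : {A : Set} → Subset A → Subset A → Set
s ⊆ t = ∀ x → x ∈ s → x ∈ t

∅ : {A : Set} → Subset A
∅ _ = false

record Behaviour (P : Set) : Set₁ where
  field
    Q      : Set
    _⟶[_]_ : Q → Subset P → Q → Set
    _⇝_    : Q → P → Set
    idle   : ∀ q → q ⟶[ ∅ ] q
    offer-ok : ∀ q a q' p → q ⟶[ a ] q' → p ∈ a → q ⇝ p

-- Typed ports: activation p, firing ṗ, negative p̄.  X = P ∪ Ṗ ∪ P̄.
data Typed (P : Set) : Set where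
  act  : P → Typed P
  fire : P → Typed P
  neg  : P → Typed P

Interaction : Set → Set
Interaction P = Subset (Typed P)

ḟsup : {P : Set} → Interaction P → Subset P
ḟsup a p = a (fire p)

-- Setting: n behaviours B_i with port sets P_i; the union P of the pairwise
-- disjoint P_i is the disjoint union Σ (Fin n) P_i.
module Composition {n : ℕ} (Ps : Fin n → Set) (Bs : (i : Fin n) → Behaviour (Ps i)) where

  Port : Set
  Port = Σ (Fin n) Ps

  State : Set
  State = (i : Fin n) → Behaviour.Q (Bs i)

  _⇝_ : State → Port → Set
  qs ⇝ (i , p) = Behaviour._⇝_ (Bs i) (qs i) p

  data Trans (γ : Interaction Port → Set) : State → Subset Port → State → Set where
    step : ∀ {qs qs'} (a : Interaction Port) → γ a →
      (∀ i → Behaviour._⟶[_]_ (Bs i) (qs i) (λ p → ḟsup a (i , p)) (qs' i)) →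
      (∀ i p → act (i , p) ∈ a → Behaviour._⇝_ (Bs i) (qs i) p) →
      (∀ i p → neg (i , p) ∈ a → ¬ Behaviour._⇝_ (Bs i) (qs i) p) →
      Trans γ qs (ḟsup a) qs'

-- A step of the composition through an interaction c only uses c through its firing
-- support, its activation ports (which must be offered) and its negative ports (which
-- must not be). Shrinking c to some b ⊆ c with the same firing support keeps the label
-- and weakens the offer conditions, so b already produces every step that c produces.
module Submission where

open import Defs
open import Data.Nat using (ℕ)
open import Data.Fin using (Fin)
open import Data.Product using (Σ; _×_; _,_)
open import Data.Sum using (_⊎_; inj₁; inj₂)
open import Relation.Binary.PropositionalEquality using (_≡_; refl)
open import Relation.Nullary using (¬_)
open import Function.Bundles using (_⇔_; mk⇔)

module Connectors {n : ℕ} (Ps : Fin n → Set) (Bs : (i : Fin n) → Behaviour (Ps i)) where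

  open Composition Ps Bs
  open Behaviour using (_⟶[_]_)

  Connector : Set₁
  Connector = Interaction Port → Set

  ⊆-refl : ∀ {A : Set} (s : Subset A) → s ⊆ s
  ⊆-refl s x x∈s = x∈s

  step-labelled : ∀ {γ : Connector} {qs qs' ℓ} (d : Interaction Port) → γ d → ḟsup d ≡ ℓ →
    (∀ i → _⟶[_]_ (Bs i) (qs i) (λ p → ℓ (i , p)) (qs' i)) →
    (∀ i p → act (i , p) ∈ d → Behaviour._⇝_ (Bs i) (qs i) p) →
    (∀ i p → neg (i , p) ∈ d → ¬ Behaviour._⇝_ (Bs i) (qs i) p) →
    Trans γ qs ℓ qs'
  step-labelled d γd refl = step d γd

  Trans-mono : ∀ {γ γ' : Connector} → (∀ c → γ c → γ' c) →
    ∀ {qs ℓ qs'} → Trans γ qs ℓ qs' → Trans γ' qs ℓ qs'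
  Trans-mono γ⊆γ' (step c γc moves offered refused) = step c (γ⊆γ' c γc) moves offered refused

  Dominated : Connector → Connector → Set
  Dominated γ' γ = ∀ c → γ' c → Σ (Interaction Port) (λ d → γ d × d ⊆ c × ḟsup d ≡ ḟsup c)

  Trans-dominated : ∀ {γ γ' : Connector} → Dominated γ' γ →
    ∀ {qs ℓ qs'} → Trans γ' qs ℓ qs' → Trans γ qs ℓ qs'
  Trans-dominated dom (step c γ'c moves offered refused) with dom c γ'c
  ... | d , γd , d⊆c , same-firing =
    step-labelled d γd same-firing moves
      (λ i p m → offered i p (d⊆c _ m))
      (λ i p m → refused i p (d⊆c _ m))

lemma2 : {n : ℕ} (Ps : Fin n → Set) (Bs : (i : Fin n) → Behaviour (Ps i))
    (γ₁ : Interaction (Composition.Port Ps Bs) → Set)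
    (a : Interaction (Composition.Port Ps Bs)) →
    Σ (Interaction (Composition.Port Ps Bs)) (λ b → γ₁ b × b ⊆ a × ḟsup b ≡ ḟsup a) →
    ∀ qs ℓ qs' →
    Composition.Trans Ps Bs γ₁ qs ℓ qs' ⇔
    Composition.Trans Ps Bs (λ c → γ₁ c ⊎ c ≡ a) qs ℓ qs'
lemma2 Ps Bs γ₁ a b-below-a qs ℓ qs' =
  mk⇔ (Trans-mono (λ c → inj₁)) (Trans-dominated γ₂-dominated)
  where
  open Connectors Ps Bs

  γ₂-dominated : Dominated (λ c → γ₁ c ⊎ c ≡ a) γ₁
  γ₂-dominated c (inj₁ γ₁c) = c , γ₁c , ⊆-refl c , refl
  γ₂-dominated c (inj₂ refl) = b-below-a
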